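{- Let $\mathcal{A}$ be a finite arrangement of linear hyperplanes in $\mathbb{R}^d$, $B$ a chamber, $\prec$ a linear extension of $\mathcal{T}_B(\mathcal{A})$. Then for every chamber $C$, $N(C)\simeq\mathcal{F}(\mathcal{M}/X_C)$; explicitly, $$N(C)=\{\langle F,C_F\rangle: F\text{ a face of }\mathcal{A}\text{ with }F\subseteq X_C\},$$ with the order induced from the Salvetti poset (so $N(C)$ is isomorphic to the poset of faces of the arrangement induced by $\mathcal{A}$ on $X_C$, i.e. the face poset of the contraction $\mathcal{M}/X_C$ of the oriented matroid of $\mathcal{A}$, up to the order reversal inherent in the Salvetti order).
   Context: Chambers are closures of connected components of $\mathbb{R}^d\setminus\bigcup\mathcal{A}$; $S(C,K)$ is the set of hyperplanes separating $C,K$; $\mathcal{T}_B(\mathcal{A})$ is the set of chambers ordered by $C\le K$ iff $S(B,C)\subseteq S(B,K)$. $\mathcal{L}(\mathcal{A})$: intersections of subsets of $\mathcal{A}$ ($\bigcap\emptyset=\mathbb{R}^d$) ordered by reverse inclusion; $\mathrm{supp}(X)=\{H:X\subseteq H\}$; $\mathcal{J}(C)=\{X\in\mathcal{L}(\mathcal{A}):\mathrm{supp}(X)\cap S(C,K)\ne\emptyset\ \forall K\prec C\}$, which has a minimum $X_C$. Faces: closures of the strata of the stratification of $\mathbb{R}^d$ induced by $\mathcal{A}$; $P=\bigcap\mathcal{A}$ is the minimal face. For a face $F$ and chamber $T$, $T_F$ is the chamber containing $F$ on the same side as $T$ of every hyperplane not containing $F$. The Salvetti poset $\mathcal{S}$: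 pairs $\langle F,T\rangle$, $F$ a face, $T$ a chamber, $F\subseteq T$, with $\langle F,T\rangle\le\langle F',T'\rangle$ iff $F'\subseteq F$ and $T=T'_F$. $\mathcal{S}_T=\{x\in\mathcal{S}:x\le\langle P,T\rangle\}$; $\mathcal{S}(R)=\bigcup_{T\preceq R}\mathcal{S}_T$; $N(R)=\mathcal{S}(R)\setminus\mathcal{S}(R^-)$ with $R^-$ the predecessor of $R$ in $\prec$, and $N(B)=\mathcal{S}_B$. -}

module Defs where

open import Level using (0ℓ)
open import Data.Nat using (ℕ; zero; suc)
open import Data.Fin using (Fin; zero; suc)
open import Data.Fin.Subset using (Subset; _∈_)
open import Data.Product using (Σ; ∃; _×_; _,_)
open import Data.Sum using (_⊎_)
open import Relation.Nullary using (¬_)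
open import Relation.Binary.Core using (Rel)
open import Relation.Binary.Definitions using (tri<; tri≈; tri>)
open import Relation.Binary.Structures using (IsStrictTotalOrder)
open import Relation.Binary.PropositionalEquality using (_≡_; _≢_)
open import Algebra.Structures using (IsCommutativeRing)

-- An ordered field (ℝ is an instance).  Arrangements are taken over an
-- arbitrary ordered field.

record OrderedField : Set₁ where
  infixl 6 _+_
  infixl 7 _*_
  infix 4 _<_
  field
    Carrier : Set
    0# 1# : Carrier
    _+_ _*_ : Carrier → Carrier → Carrier
    -_ : Carrier → Carrier
    _<_ : Rel Carrier 0ℓ
    isCommutativeRing : IsCommutativeRing _≡_ _+_ _*_ -_ 0# 1#
    isStrictTotalOrder : IsStrictTotalOrder _≡_ _<_
    0≢1 : 0# ≢ 1#
    inverse : ∀ x → x ≢ 0# → ∃ λ y → x * y ≡ 1#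
    +-mono-< : ∀ {x y} z → x < y → x + z < y + z
    *-pos : ∀ {x y} → 0# < x → 0# < y → 0# < x * y

data Sign : Set where
  neg zer pos : Sign

SV : ℕ → Set
SV n = Fin n → Sign

_≗ₛ_ : ∀ {n} → SV n → SV n → Set
σ ≗ₛ τ = ∀ i → σ i ≡ τ i

-- conformal order: closure of the stratum σ is contained in closure of τ
_⊑_ : ∀ {n} → SV n → SV n → Set
σ ⊑ τ = ∀ i → σ i ≡ zer ⊎ σ i ≡ τ i

_∘ₛ_ : ∀ {n} → SV n → SV n → SV n
(σ ∘ₛ τ) i with σ i
... | zer = τ i
... | s   = s

-- the all-zero sign vector (the minimal face P = ⋂ 𝒜 = {0})
zeroSV : ∀ {n} → SV n
zeroSV _ = zer

-- A linear arrangement of n hyperplanes H_i = { x | a i · x = 0 } in K^d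

module Arr (K : OrderedField) {d n : ℕ} (a : Fin n → Fin d → OrderedField.Carrier K) where
  open OrderedField K

  Point : Set
  Point = Fin d → Carrier

  Σ[_] : ∀ {m} → (Fin m → Carrier) → Carrier
  Σ[_] {zero}  f = 0#
  Σ[_] {suc m} f = f zero + Σ[ (λ i → f (suc i)) ]

  dot : Point → Point → Carrier
  dot u v = Σ[ (λ k → u k * v k) ]

  _∈H_ : Point → Fin n → Set
  x ∈H i = dot (a i) x ≡ 0#

  sgn : Carrier → Sign
  sgn x with IsStrictTotalOrder.compare isStrictTotalOrder 0# x
  ... | tri< _ _ _ = pos
  ... | tri≈ _ _ _ = zer
  ... | tri> _ _ _ = neg

  sv : Point → SV n
  sv x i = sgn (dot (a i) x)

  IsArrangement : Set
  IsArrangement =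
    (∀ i → ¬ (∀ k → a i k ≡ 0#)) ×
    (∀ i j → (∀ x → (x ∈H i → x ∈H j) × (x ∈H j → x ∈H i)) → i ≡ j)

  -- a face: a stratum, given by its (realized) sign vector; the face is its closure
  record Face : Set where
    constructor face
    field
      σ : SV n
      realized : ∃ λ x → sv x ≗ₛ σ
  open Face public

  _∈stratum_ : Point → Face → Set
  x ∈stratum F = sv x ≗ₛ σ F

  record Chamber : Set where
    constructor chamber
    field
      cface : Face
      nonzero : ∀ i → σ cface i ≢ zer
  open Chamber public

  csv : Chamber → SV n
  csv C = σ (cface C)

  Sep : Chamber → Chamber → Fin n → Set
  Sep C K i = csv C i ≢ csv K i

  _≈C_ : Chamber → Chamber → Set
  C ≈C K = csv C ≗ₛ csv K

  -- the order of 𝒯_B(𝒜)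
  _≤[_]_ : Chamber → Chamber → Chamber → Set
  C ≤[ B ] K = ∀ i → Sep B C i → Sep B K i

  record LinearExtension (B : Chamber) : Set₁ where
    field
      _≺_ : Chamber → Chamber → Set
      isStrictTotalOrder≺ : IsStrictTotalOrder _≈C_ _≺_
      extends : ∀ C K → C ≤[ B ] K → ¬ (C ≈C K) → C ≺ K

  record Salv : Set where
    constructor ⟨_,_⟩[_]
    field
      sF : Face
      sT : Chamber
      F⊆T : σ sF ⊑ csv sT
  open Salv public

  -- ⟨F,T⟩ ≤ ⟨F',T'⟩ iff F' ⊆ F and T = T'_F  (T'_F has sign vector F ∘ T')
  _≤S_ : Salv → Salv → Set
  x ≤S y = (σ (sF y) ⊑ σ (sF x)) × (csv (sT x) ≗ₛ (σ (sF x) ∘ₛ csv (sT y)))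

  -- x ∈ 𝒮_T  iff  x ≤ ⟨P,T⟩  (P the minimal face, sign vector all zero)
  _∈𝒮_ : Salv → Chamber → Set
  x ∈𝒮 T = (zeroSV ⊑ σ (sF x)) × (csv (sT x) ≗ₛ (σ (sF x) ∘ₛ csv T))

  module _ {B : Chamber} (L : LinearExtension B) where
    open LinearExtension L

    _⪯_ : Chamber → Chamber → Set
    T ⪯ R = T ≺ R ⊎ T ≈C R

    -- x ∈ N(R) = 𝒮(R) ∖ 𝒮(R⁻), with 𝒮(R⁻) = ⋃_{T ≺ R} 𝒮_T (empty for R = B)
    _∈N_ : Salv → Chamber → Set
    x ∈N R = (∃ λ T → T ⪯ R × x ∈𝒮 T) × ¬ (∃ λ T → T ≺ R × x ∈𝒮 T)

    -- elements of ℒ(𝒜): X = ⋂_{i ∈ I} H_i for a subset I of 𝒜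
    _∈X_ : Point → Subset n → Set
    x ∈X I = ∀ i → i ∈ I → x ∈H i

    _∈supp_ : Fin n → Subset n → Set
    i ∈supp I = ∀ x → x ∈X I → x ∈H i

    In𝒥 : Chamber → Subset n → Set
    In𝒥 C I = ∀ K → K ≺ C → ∃ λ i → i ∈supp I × Sep C K i

    -- X is the minimum X_C of 𝒥(C) (ℒ ordered by reverse inclusion)
    IsX : Chamber → Subset n → Set
    IsX C I = In𝒥 C I × (∀ I' → In𝒥 C I' → ∀ x → x ∈X I' → x ∈X I)

    _⊆X_ : Face → Subset n → Set
    F ⊆X I = ∀ x → x ∈stratum F → x ∈X I

{-# OPTIONS --safe #-}
-- An element ⟨F,T⟩ lies in 𝒮_K exactly when T = F ∘ K, so it lies in 𝒮_C and in
-- 𝒮_K iff C and K agree on every hyperplane containing F.  Hence ⟨F, F ∘ C⟩ is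
-- new at C (in no 𝒮_K with K ≺ C) iff every K ≺ C is separated from C by a
-- hyperplane containing F, i.e. iff the flat spanned by F lies in 𝒥(C); by
-- minimality of X_C this means F ⊆ X_C, and conversely F ⊆ X_C forces F to be zero
-- on every separating hyperplane of supp(X_C).  On N(C) the chamber coordinate is
-- F ∘ C, and F ∘ (G ∘ C) = F ∘ C whenever G ⊑ F, so the Salvetti order is just the
-- (reversed) face order.
module Submission where

open import Defs
open import Data.Nat using (ℕ)
open import Data.Fin using (Fin)
open import Data.Fin.Subset using (Subset; Side; inside; outside)
open import Data.Fin.Properties using (any?)
open import Data.Product using (_×_; _,_; proj₁; proj₂; ∃)
open import Data.Sum using (_⊎_; inj₁; inj₂)
open import Data.Empty using (⊥-elim)
open import Data.Vec using (tabulate)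
open import Data.Vec.Properties using (lookup∘tabulate; []=⇒lookup; lookup⇒[]=)
open import Relation.Nullary using (¬_; Dec; yes; no)
open import Relation.Nullary.Decidable using (_×-dec_; ¬?; decidable-stable)
open import Relation.Binary.Definitions using (tri<; tri≈; tri>)
open import Relation.Binary.Structures using (IsStrictTotalOrder)
open import Relation.Binary.PropositionalEquality using (_≡_; _≢_; refl; sym; trans; cong; module ≡-Reasoning)
open import Function.Bundles using (_⇔_; mk⇔; Equivalence)

_≟ₛ_ : (s t : Sign) → Dec (s ≡ t)
neg ≟ₛ neg = yes refl
neg ≟ₛ zer = no λ ()
neg ≟ₛ pos = no λ ()
zer ≟ₛ neg = no λ ()
zer ≟ₛ zer = yes refl
zer ≟ₛ pos = no λ ()
pos ≟ₛ neg = no λ ()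
pos ≟ₛ zer = no λ ()
pos ≟ₛ pos = yes refl

module _ {n : ℕ} where

  AgreeOnZeros : SV n → SV n → SV n → Set
  AgreeOnZeros σ τ τ′ = ∀ i → σ i ≡ zer → τ i ≡ τ′ i

  agreeOnZeros-or-differ : (σ τ τ′ : SV n) →
    AgreeOnZeros σ τ τ′ ⊎ ∃ λ i → σ i ≡ zer × τ i ≢ τ′ i
  agreeOnZeros-or-differ σ τ τ′
    with any? (λ i → (σ i ≟ₛ zer) ×-dec ¬? (τ i ≟ₛ τ′ i))
  ... | yes differ = inj₂ differ
  ... | no ¬differ = inj₁ λ i σi≡zer →
    decidable-stable (τ i ≟ₛ τ′ i) λ τi≢τ′i → ¬differ (i , σi≡zer , τi≢τ′i)

  ∘ₛ-zer : (σ τ : SV n) (i : Fin n) → σ i ≡ zer → (σ ∘ₛ τ) i ≡ τ i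
  ∘ₛ-zer σ τ i σi≡zer with σ i
  ∘ₛ-zer σ τ i refl | .zer = refl

  ∘ₛ-congʳ : (σ : SV n) {τ τ′ : SV n} → AgreeOnZeros σ τ τ′ → (σ ∘ₛ τ) ≗ₛ (σ ∘ₛ τ′)
  ∘ₛ-congʳ σ agree i with σ i in σi
  ... | neg = refl
  ... | zer = agree i σi
  ... | pos = refl

  ∘ₛ-cancelˡ : (σ : SV n) {τ τ′ : SV n} → (σ ∘ₛ τ) ≗ₛ (σ ∘ₛ τ′) → AgreeOnZeros σ τ τ′
  ∘ₛ-cancelˡ σ {τ} {τ′} eq i σi≡zer =
    trans (sym (∘ₛ-zer σ τ i σi≡zer)) (trans (eq i) (∘ₛ-zer σ τ′ i σi≡zer))

  ∘ₛ-absorbˡ : {σ ρ : SV n} (τ : SV n) → ρ ⊑ σ → (σ ∘ₛ (ρ ∘ₛ τ)) ≗ₛ (σ ∘ₛ τ)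
  ∘ₛ-absorbˡ {σ} {ρ} τ ρ⊑σ = ∘ₛ-congʳ σ ρ∘τ≡τ
    where
    ρ∘τ≡τ : AgreeOnZeros σ (ρ ∘ₛ τ) τ
    ρ∘τ≡τ i σi≡zer with ρ⊑σ i
    ... | inj₁ ρi≡zer = ∘ₛ-zer ρ τ i ρi≡zer
    ... | inj₂ ρi≡σi  = ∘ₛ-zer ρ τ i (trans ρi≡σi σi≡zer)

isZer : Sign → Side
isZer zer = inside
isZer _   = outside

isZer-inside : ∀ s → isZer s ≡ inside → s ≡ zer
isZer-inside zer _ = refl
isZer-inside neg ()
isZer-inside pos ()

-- The set of hyperplanes containing a face; its intersection is the flat spanned by the face.
zeros : ∀ {n} → SV n → Subset n
zeros σ = tabulate (λ i → isZer (σ i))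

module SalvettiFiltration (K : OrderedField) {d n : ℕ} (a : Fin n → Fin d → OrderedField.Carrier K) where
  open OrderedField K
  open IsStrictTotalOrder isStrictTotalOrder using (compare; irrefl)
  open Arr K a

  sgn≡zer⇒≡0# : ∀ x → sgn x ≡ zer → x ≡ 0#
  sgn≡zer⇒≡0# x _ with compare 0# x
  sgn≡zer⇒≡0# x _  | tri≈ _ 0≡x _ = sym 0≡x
  sgn≡zer⇒≡0# x () | tri< _ _ _
  sgn≡zer⇒≡0# x () | tri> _ _ _

  ≡0#⇒sgn≡zer : ∀ x → x ≡ 0# → sgn x ≡ zer
  ≡0#⇒sgn≡zer x x≡0 with compare 0# x
  ... | tri≈ _ _ _ = refl
  ... | tri< 0<x _ _ = ⊥-elim (irrefl (sym x≡0) 0<x)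
  ... | tri> _ _ x<0 = ⊥-elim (irrefl x≡0 x<0)

  ∈𝒮⁺ : ∀ x T → csv (sT x) ≗ₛ (σ (sF x) ∘ₛ csv T) → x ∈𝒮 T
  ∈𝒮⁺ _ _ eq = (λ _ → inj₁ refl) , eq

  ∈𝒮-resp-≈C : ∀ x T T′ → T ≈C T′ → x ∈𝒮 T → x ∈𝒮 T′
  ∈𝒮-resp-≈C x _ T′ T≈T′ (_ , eq) =
    ∈𝒮⁺ x T′ λ i → trans (eq i) (∘ₛ-congʳ (σ (sF x)) (λ j _ → T≈T′ j) i)

  module _ {B : Chamber} (L : LinearExtension B) where
    open LinearExtension L

    face⊆flat : ∀ F {p} → p ∈stratum F → _∈X_ L p (zeros (σ F))
    face⊆flat F p∈F i i∈zeros = sgn≡zer⇒≡0# _ (trans (p∈F i) (isZer-inside (σ F i)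
      (trans (sym (lookup∘tabulate _ i)) ([]=⇒lookup i∈zeros))))

    ∈flat-supp : ∀ F i → σ F i ≡ zer → _∈supp_ L i (zeros (σ F))
    ∈flat-supp F i σi≡zer p p∈flat =
      p∈flat i (lookup⇒[]= i _ (trans (lookup∘tabulate _ i) (cong isZer σi≡zer)))

    ⊆X⇒supp-zer : ∀ F {X} → _⊆X_ L F X → ∀ i → _∈supp_ L i X → σ F i ≡ zer
    ⊆X⇒supp-zer F F⊆X i i∈supp with realized F
    ... | p , p∈F = trans (sym (p∈F i)) (≡0#⇒sgn≡zer _ (i∈supp p (F⊆X p p∈F)))

    new-at-C⇒flat∈𝒥 : ∀ x {C} → x ∈𝒮 C → ¬ (∃ λ T → T ≺ C × x ∈𝒮 T) →
      In𝒥 L C (zeros (σ (sF x)))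
    new-at-C⇒flat∈𝒥 x {C} (_ , eqC) notEarlier T T≺C
      with agreeOnZeros-or-differ (σ (sF x)) (csv C) (csv T)
    ... | inj₂ (i , σi≡zer , sep) = i , ∈flat-supp (sF x) i σi≡zer , sep
    ... | inj₁ agree = ⊥-elim (notEarlier (T , T≺C ,
      ∈𝒮⁺ x T λ i → trans (eqC i) (∘ₛ-congʳ (σ (sF x)) agree i)))

    ⊆X∈𝒥⇒not-earlier : ∀ x {C X} → In𝒥 L C X → _⊆X_ L (sF x) X → x ∈𝒮 C →
      ¬ (∃ λ T → T ≺ C × x ∈𝒮 T)
    ⊆X∈𝒥⇒not-earlier x {C} X∈𝒥 F⊆X (_ , eqC) (T , T≺C , _ , eqT)
      with X∈𝒥 T T≺C
    ... | i , i∈supp , sep = sep (∘ₛ-cancelˡ (σ (sF x))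
      (λ j → trans (sym (eqC j)) (eqT j)) i (⊆X⇒supp-zer (sF x) F⊆X i i∈supp))

    module _ {C : Chamber} {X : Subset n} (isX : IsX L C X) where

      ∈N⇔ : (x : Salv) →
        _∈N_ L x C ⇔ (_⊆X_ L (sF x) X × csv (sT x) ≗ₛ (σ (sF x) ∘ₛ csv C))
      ∈N⇔ x = mk⇔ to from
        where
        to : _∈N_ L x C → _⊆X_ L (sF x) X × csv (sT x) ≗ₛ (σ (sF x) ∘ₛ csv C)
        to ((T , inj₁ T≺C , x∈𝒮T) , notEarlier) = ⊥-elim (notEarlier (T , T≺C , x∈𝒮T))
        to ((T , inj₂ T≈C , x∈𝒮T) , notEarlier) =
          (λ p p∈F → X-minimal p (face⊆flat (sF x) p∈F)) , proj₂ x∈𝒮C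
          where
          x∈𝒮C : x ∈𝒮 C
          x∈𝒮C = ∈𝒮-resp-≈C x T C T≈C x∈𝒮T
          X-minimal : ∀ p → _∈X_ L p (zeros (σ (sF x))) → _∈X_ L p X
          X-minimal = proj₂ isX _ (new-at-C⇒flat∈𝒥 x x∈𝒮C notEarlier)

        from : _⊆X_ L (sF x) X × csv (sT x) ≗ₛ (σ (sF x) ∘ₛ csv C) → _∈N_ L x C
        from (F⊆X , eqC) = (C , inj₂ (λ _ → refl) , ∈𝒮⁺ x C eqC)
                         , ⊆X∈𝒥⇒not-earlier x (proj₁ isX) F⊆X (∈𝒮⁺ x C eqC)

      ≤S⇔⊒ : (x y : Salv) → _∈N_ L x C → _∈N_ L y C → x ≤S y ⇔ (σ (sF y) ⊑ σ (sF x))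
      ≤S⇔⊒ x y x∈N y∈N = mk⇔ proj₁ λ Fy⊑Fx → Fy⊑Fx , Tx≡Fx∘Ty Fy⊑Fx
        where
        open ≡-Reasoning

        Tx≡Fx∘C : csv (sT x) ≗ₛ (σ (sF x) ∘ₛ csv C)
        Tx≡Fx∘C = proj₂ (Equivalence.to (∈N⇔ x) x∈N)
        Ty≡Fy∘C : csv (sT y) ≗ₛ (σ (sF y) ∘ₛ csv C)
        Ty≡Fy∘C = proj₂ (Equivalence.to (∈N⇔ y) y∈N)

        Tx≡Fx∘Ty : σ (sF y) ⊑ σ (sF x) → csv (sT x) ≗ₛ (σ (sF x) ∘ₛ csv (sT y))
        Tx≡Fx∘Ty Fy⊑Fx i = begin
          csv (sT x) i                              ≡⟨ Tx≡Fx∘C i ⟩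
          (σ (sF x) ∘ₛ csv C) i                     ≡⟨ ∘ₛ-absorbˡ (csv C) Fy⊑Fx i ⟨
          (σ (sF x) ∘ₛ (σ (sF y) ∘ₛ csv C)) i       ≡⟨ ∘ₛ-congʳ (σ (sF x)) (λ j _ → Ty≡Fy∘C j) i ⟨
          (σ (sF x) ∘ₛ csv (sT y)) i                ∎

lemma4p20 : (K : OrderedField) (d n : ℕ) (a : Fin n → Fin d → OrderedField.Carrier K) →
    let open Arr K a in
    IsArrangement → (B : Chamber) (L : LinearExtension B) (C : Chamber) (X : Subset n) →
    IsX L C X →
    ((x : Salv) → _∈N_ L x C ⇔ (_⊆X_ L (sF x) X × csv (sT x) ≗ₛ (σ (sF x) ∘ₛ csv C))) ×
    ((x y : Salv) → _∈N_ L x C → _∈N_ L y C → x ≤S y ⇔ (σ (sF y) ⊑ σ (sF x)))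
lemma4p20 K d n a _ B L C X isX = ∈N⇔ L isX , ≤S⇔⊒ L isX
  where open SalvettiFiltration K a
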